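{- Let $\Pi$ be an LCL problem in rooted trees and let $(\gamma_1,\gamma_2)$ be a path-inflexible pair in $\mathcal{M}(\Pi)$. Then for every $p_1,p_2\in\mathbb{N}$, not all of the following walks exist in $\mathcal{M}(\Pi)$: (i) a walk $\gamma_1\leadsto\gamma_2$ of length $p_1$; (ii) a walk $\gamma_1\leadsto\gamma_2$ of length $p_1+1$; (iii) a walk $\gamma_2\leadsto\gamma_1$ of length $p_2$; (iv) a walk $\gamma_2\leadsto\gamma_1$ of length $p_2+1$.
   Context: An LCL problem in rooted trees is a triple $\Pi=(\delta,\Gamma,C)$ with $\delta\ge1$, $\Gamma$ a finite label set, and $C\subseteq\Gamma^{\delta+1}$ a set of allowed configurations $(a:b_1\dots b_\delta)$. $\mathcal{M}(\Pi)$ is the directed graph (unary non-deterministic semiautomaton) with vertex set $\Gamma$ and a transition $a\to b$ iff there is a configuration $(a:b_1\dots b_\delta)\in C$ with $b=b_i$ for some $i$. A pair of labels $(\gamma_1,\gamma_2)$ is path-flexible if there is a constant $K$ such that for every $d\ge K$ there exist walks $\gamma_1\leadsto\gamma_2$ and $\gamma_2\leadsto\gamma_1$ of length exactly $d$ in $\mathcal{M}(\Pi)$; otherwise it is path-inflexible. -}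

module Defs where

open import Data.Nat using (ℕ; zero; suc; _≥_)
open import Data.Fin using (Fin)
open import Data.Vec using (Vec)
open import Data.Vec.Membership.Propositional using () renaming (_∈_ to _∈ᵥ_)
open import Data.List using (List)
open import Data.List.Membership.Propositional using (_∈_)
open import Data.Product using (Σ; ∃; ∃-syntax; _×_; _,_)
open import Relation.Nullary using (¬_)

-- An LCL problem in rooted trees: Π = (δ, Γ, C), δ ≥ 1, Γ a finite label set
-- (represented as Fin nLabels), C a finite set of configurations (a : b₁ … b_δ).
record LCL : Set where
  field
    δ       : ℕ
    δ≥1     : δ ≥ 1
    nLabels : ℕ
    C       : List (Fin nLabels × Vec (Fin nLabels) δ)

  Γ : Set
  Γ = Fin nLabels

open LCL public

Trans : (Π : LCL) → Γ Π → Γ Π → Set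
Trans Π a b = ∃[ bs ] ((a , bs) ∈ C Π × b ∈ᵥ bs)

data Walk (Π : LCL) : Γ Π → Γ Π → ℕ → Set where
  nil  : ∀ {a} → Walk Π a a zero
  cons : ∀ {a b c d} → Trans Π a b → Walk Π b c d → Walk Π a c (suc d)

PathFlexible : (Π : LCL) → Γ Π → Γ Π → Set
PathFlexible Π γ₁ γ₂ =
  ∃[ K ] (∀ d → d ≥ K → Walk Π γ₁ γ₂ d × Walk Π γ₂ γ₁ d)

PathInflexible : (Π : LCL) → Γ Π → Γ Π → Set
PathInflexible Π γ₁ γ₂ = ¬ PathFlexible Π γ₁ γ₂

-- Gluing u : γ₁ ⇝ γ₂ (lengths p₁ and p₁ + 1) with v : γ₂ ⇝ γ₁ (length p₂) gives
-- closed walks at γ₁ of the consecutive lengths L = p₁ + p₂ and L + 1. Every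
-- n ≥ L² is a non-negative combination of L and L + 1: writing n − L² = qL + r
-- with r < L, n = r(L + 1) + (L − r + q)L. So γ₁ has closed walks of every length
-- ≥ L², and appending u or prepending v yields walks γ₁ ⇝ γ₂ and γ₂ ⇝ γ₁ of every
-- length ≥ L² + L: the pair would be path-flexible.
module Submission where

open import Defs
open import Data.Nat using (ℕ; zero; suc; _+_; _*_; _∸_; _≥_; _/_; _%_)
open import Data.Nat.Properties using (*-identityʳ; <⇒≤; m+[n∸m]≡n; m≤n⇒∃[o]m+o≡n)
open import Data.Nat.DivMod using (m≡m%n+[m/n]*n; m%n<n)
open import Data.Nat.Solver using (module +-*-Solver)
open import Data.Product using (_×_; _,_)
open import Relation.Nullary using (¬_)
open import Relation.Binary.PropositionalEquality
  using (_≡_; refl; sym; cong; subst; module ≡-Reasoning)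

open +-*-Solver using (solve; _:=_; _:+_; _:*_; con)

square+division≡mixed-combination : ∀ r s q →
  (r + s) * (r + s) + (r + q * (r + s)) ≡ r * suc (r + s) + (s + q) * (r + s)
square+division≡mixed-combination = solve 3
  (λ r s q → (r :+ s) :* (r :+ s) :+ (r :+ q :* (r :+ s))
           := r :* (con 1 :+ (r :+ s)) :+ (s :+ q) :* (r :+ s))
  refl

module _ {Π : LCL} where

  _++_ : ∀ {a b c m n} → Walk Π a b m → Walk Π b c n → Walk Π a c (m + n)
  nil      ++ w = w
  cons t v ++ w = cons t (v ++ w)

  repeat : ∀ {x m} k → Walk Π x x m → Walk Π x x (k * m)
  repeat zero    w = nil
  repeat (suc k) w = w ++ repeat k w

  closedWalk-combination : ∀ {x m} → Walk Π x x m → Walk Π x x (suc m) →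
    ∀ j k → Walk Π x x (j * suc m + k * m)
  closedWalk-combination c c′ j k = repeat j c′ ++ repeat k c

  closedWalk-≥-square : ∀ {x m} → Walk Π x x m → Walk Π x x (suc m) →
    ∀ n → Walk Π x x (m * m + n)
  closedWalk-≥-square {m = zero} c c′ n =
    subst (Walk Π _ _) (*-identityʳ n) (repeat n c′)
  closedWalk-≥-square {m = m@(suc _)} c c′ n =
    subst (Walk Π _ _) (sym square+n≡combination)
      (closedWalk-combination c c′ r (s + q))
    where
      r = n % m
      q = n / m
      s = m ∸ r

      r+s≡m : r + s ≡ m
      r+s≡m = m+[n∸m]≡n (<⇒≤ (m%n<n n m))

      square+n≡combination : m * m + n ≡ r * suc m + (s + q) * m
      square+n≡combination = begin
        m * m + n            ≡⟨ cong (m * m +_) (m≡m%n+[m/n]*n n m) ⟩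
        m * m + (r + q * m)  ≡⟨ subst (λ l → l * l + (r + q * l) ≡ r * suc l + (s + q) * l)
                                      r+s≡m (square+division≡mixed-combination r s q) ⟩
        r * suc m + (s + q) * m ∎
        where open ≡-Reasoning

  pathFlexible-from-closedWalks : ∀ {γ₁ γ₂ p₁ p₂ N} →
    (∀ n → Walk Π γ₁ γ₁ (N + n)) → Walk Π γ₁ γ₂ p₁ → Walk Π γ₂ γ₁ p₂ →
    PathFlexible Π γ₁ γ₂
  pathFlexible-from-closedWalks {γ₁} {γ₂} {p₁} {p₂} {N} loop u v = N + (p₁ + p₂) , walks
    where
      there-length : ∀ e → N + (p₂ + e) + p₁ ≡ N + (p₁ + p₂) + e
      there-length = solve 4 (λ N p₁ p₂ e → N :+ (p₂ :+ e) :+ p₁ := N :+ (p₁ :+ p₂) :+ e)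
                       refl N p₁ p₂
      back-length : ∀ e → p₂ + (N + (p₁ + e)) ≡ N + (p₁ + p₂) + e
      back-length = solve 4 (λ N p₁ p₂ e → p₂ :+ (N :+ (p₁ :+ e)) := N :+ (p₁ :+ p₂) :+ e)
                      refl N p₁ p₂

      walks : ∀ d → d ≥ N + (p₁ + p₂) → Walk Π γ₁ γ₂ d × Walk Π γ₂ γ₁ d
      walks d d≥K with m≤n⇒∃[o]m+o≡n d≥K
      ... | e , refl = subst (Walk Π _ _) (there-length e) (loop (p₂ + e) ++ u)
                     , subst (Walk Π _ _) (back-length e) (v ++ loop (p₁ + e))

lemmaE8 : (Π : LCL) (γ₁ γ₂ : Γ Π) → PathInflexible Π γ₁ γ₂ →
    (p₁ p₂ : ℕ) →
    ¬ (Walk Π γ₁ γ₂ p₁ × Walk Π γ₁ γ₂ (suc p₁) ×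
       Walk Π γ₂ γ₁ p₂ × Walk Π γ₂ γ₁ (suc p₂))
lemmaE8 Π γ₁ γ₂ inflexible p₁ p₂ (u , u′ , v , _) =
  inflexible (pathFlexible-from-closedWalks (closedWalk-≥-square (u ++ v) (u′ ++ v)) u v)
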